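{- Let $\alpha$ be a type-$B$ composition of $n$. For every $\pi\in\mathfrak{H}_\alpha$, there is a unique element $\pi_\dagger\in\mathfrak{H}_\alpha(312)$ with $\mathsf{Inv}(\pi_\dagger)\subseteq\mathsf{Inv}(\pi)$ such that $\mathsf{Inv}(\pi_\dagger)$ is maximal by inclusion among all elements $\sigma\in\mathfrak{H}_\alpha(312)$ with $\mathsf{Inv}(\sigma)\subseteq\mathsf{Inv}(\pi)$.
   Context: $\mathfrak{H}_n$: permutations $\pi$ of $\pm[n]=\{ -n,\dots,-1,1,\dots,n\}$ with $\pi(-a)=-\pi(a)$, product = composition; Coxeter group of type $B_n$ with simple generators $s_0$ (exchanging $1,-1$), $s_i$ (exchanging $i,i+1$ and $-i,-i-1$); $\ell_S$ Coxeter length. $\mathsf{Inv}(\pi)$ (the reflections $t$ with $\ell_S(\pi t)<\ell_S(\pi)$) consists of $[\![i]\!]$ (exchanging $i,-i$) with $\pi(i)<0$, $(\!(i\;j)\!)$ ($0<i<j$, exchanging $i,j$ and $-i,-j$) with $\pi(i)>\pi(j)$, and $(\!(-j\;i)\!)$ ($0<i<j$) with $\pi(-j)>\pi(i)$. Type-$B$ composition of $n$: positive integers $(\alpha_1,\dots,\alpha_r)$ summing to $n$, possibly preceded by a component $0$ (split if present, join otherwise); $p_0=0$, $p_i=\alpha_1+\dots+\alpha_i$. $\mathsf{Part}(\alpha)$: blocks $\{p_{i-1}+1,\dots,p_i\}$, $\{ -p_i,\dots,-p_{i-1}-1\}$ ($1\le i\le r$), the two $i=1$ blocks merged when $\alpha$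 is join. $\mathfrak{H}_\alpha=\{w:\ell_S(ws)>\ell_S(w)\ \forall s\in S\setminus J_\alpha\}$, $J_\alpha=\{s_{p_1},\dots,s_{p_{r-1}}\}$ plus $s_0$ if split; equivalently the $\pi$ increasing on each block. $x^+=x+1$ for $x\ne-1$, $(-1)^+=1$. A type-$B$ $(\alpha,312)$-pattern of $\pi\in\mathfrak{H}_\alpha$ is a triple $i<j<k$ in $\pm[n]$ in pairwise different blocks with $j>0$, $\pi(i)=\pi(k)^+$, and: if $\alpha$ is split, $\pi(k)>\pi(j)$; if $\alpha$ is join, ($j>\alpha_1$ and $\pi(k)>\pi(j)$) or ($0<j\le\alpha_1$ and $\pi(j)>\pi(i)$). $\mathfrak{H}_\alpha(312)$ is the set of elements of $\mathfrak{H}_\alpha$ without such a pattern. -}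

module Defs where

open import Data.Bool using (Bool; true; false; if_then_else_; not; _∧_)
open import Data.Nat as ℕ using (ℕ; zero; suc; _≡ᵇ_; _≤ᵇ_; _∸_)
open import Data.Integer as ℤ using (ℤ; +_; -[1+_]; -_; ∣_∣; 0ℤ; 1ℤ; _<_; _≤_; _>_)
open import Data.List using (List; []; _∷_)
open import Data.Nat.ListAction using (sum)
open import Data.List.Relation.Unary.All using (All)
open import Data.Product using (Σ; _×_; _,_)
open import Data.Sum using (_⊎_)
open import Relation.Binary.PropositionalEquality using (_≡_; _≢_)
open import Relation.Nullary using (¬_)

InPM : ℕ → ℤ → Set
InPM n x = (x ≢ 0ℤ) × (∣ x ∣ ℕ.≤ n)

-- 𝔥_n : permutations π of ±[n] with π(-a) = -π(a)
-- (the function is only relevant on ±[n]; values outside are ignored)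

record SignedPerm (n : ℕ) : Set where
  field
    fun      : ℤ → ℤ
    inv      : ℤ → ℤ
    fun-into : ∀ x → InPM n x → InPM n (fun x)
    inv-into : ∀ x → InPM n x → InPM n (inv x)
    inv-fun  : ∀ x → InPM n x → inv (fun x) ≡ x
    fun-inv  : ∀ x → InPM n x → fun (inv x) ≡ x
    odd      : ∀ x → InPM n x → fun (- x) ≡ - fun x

open SignedPerm public

_≈ₚ_ : ∀ {n} → SignedPerm n → SignedPerm n → Set
_≈ₚ_ {n} π σ = ∀ x → InPM n x → fun π x ≡ fun σ x

-- Reflections of type B_n, with the context's description of Inv(π)
--   bar i     = [[i]]      (exchanging i, -i),             1 ≤ i ≤ n
--   pos i j   = ((i j))    (0 < i < j ≤ n)
--   neg j i   = ((-j i))   (0 < i < j ≤ n)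

data Refl : Set where
  bar : ℕ → Refl
  pos : ℕ → ℕ → Refl
  neg : ℕ → ℕ → Refl

Inv : ∀ {n} → SignedPerm n → Refl → Set
Inv {n} π (bar i)   = (1 ℕ.≤ i) × (i ℕ.≤ n) × (fun π (+ i) < 0ℤ)
Inv {n} π (pos i j) = (1 ℕ.≤ i) × (i ℕ.< j) × (j ℕ.≤ n) × (fun π (+ i) > fun π (+ j))
Inv {n} π (neg j i) = (1 ℕ.≤ i) × (i ℕ.< j) × (j ℕ.≤ n) × (fun π (- (+ j)) > fun π (+ i))

_⊆ᵢ_ : ∀ {n} → SignedPerm n → SignedPerm n → Set
σ ⊆ᵢ π = ∀ t → Inv σ t → Inv π t

-- Type-B compositions of n: positive parts (α₁,…,α_r) summing to n,
-- with a flag telling whether a leading component 0 is present (split).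

record TypeBComp (n : ℕ) : Set where
  field
    split    : Bool
    parts    : List ℕ
    positive : All (λ a → 1 ℕ.≤ a) parts
    sums     : sum parts ≡ n

open TypeBComp public

-- index (1-based) of the block {p_{i-1}+1,…,p_i} containing k (for 1 ≤ k ≤ n)
blk : List ℕ → ℕ → ℕ
blk []       k = zero
blk (a ∷ as) k = if k ≤ᵇ a then 1 else suc (blk as (k ∸ a))

first : List ℕ → ℕ
first []      = 0
first (a ∷ _) = a

-- block label of x ∈ ±[n]: block i of positives ↦ +i, its negative ↦ -i;
-- if α is join, the two blocks with i = 1 are merged (label 0).
label : ∀ {n} → TypeBComp n → ℤ → ℤ
label α (+ k) =
  let b = blk (parts α) k in
  if (not (split α) ∧ (b ≡ᵇ 1)) then 0ℤ else + b
label α -[1+ k ] =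
  let b = blk (parts α) (suc k) in
  if (not (split α) ∧ (b ≡ᵇ 1)) then 0ℤ else - (+ b)

InQuot : ∀ {n} → TypeBComp n → SignedPerm n → Set
InQuot {n} α π = ∀ x y → InPM n x → InPM n y → label α x ≡ label α y →
                 x < y → fun π x < fun π y

_⁺ : ℤ → ℤ
(-[1+ zero ]) ⁺ = 1ℤ
x ⁺ = x ℤ.+ 1ℤ

Pattern312 : ∀ {n} → TypeBComp n → SignedPerm n → ℤ → ℤ → ℤ → Set
Pattern312 {n} α π i j k =
  InPM n i × InPM n j × InPM n k × i < j × j < k ×
  label α i ≢ label α j × label α j ≢ label α k × label α i ≢ label α k ×
  0ℤ < j × fun π i ≡ (fun π k) ⁺ × cond (split α)
  where
  cond : Bool → Set
  cond true  = fun π k > fun π j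
  cond false = ((+ first (parts α)) < j × fun π k > fun π j)
             ⊎ (j ≤ + first (parts α) × fun π j > fun π i)

Avoid312 : ∀ {n} → TypeBComp n → SignedPerm n → Set
Avoid312 α π = ∀ i j k → ¬ Pattern312 α π i j k

IsDagger : ∀ {n} → TypeBComp n → SignedPerm n → SignedPerm n → Set
IsDagger {n} α π ρ =
  InQuot α ρ × Avoid312 α ρ × ρ ⊆ᵢ π ×
  (∀ (σ : SignedPerm n) → InQuot α σ → Avoid312 α σ → σ ⊆ᵢ π →
     ρ ⊆ᵢ σ → σ ⊆ᵢ ρ)

-- Order signed permutations by inclusion of inversion sets, σ ⊑ π. If π ∈ 𝔥_α has an
-- (α,312)-pattern (i, j, k), exchanging the adjacent values π k and π i = π k ⁺ (together with
-- their negatives) gives π′ ∈ 𝔥_α with π′ ⊑ π and fewer inversions, and every σ ∈ 𝔥_α(312)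
-- with σ ⊑ π still satisfies σ ⊑ π′: otherwise σ k < σ i, and the consecutive values between
-- them crossing from positions after j to positions before j give a pattern of σ. Repeating
-- until no pattern is left yields the greatest element of 𝔥_α(312) below π; it is maximal,
-- and unique because σ ⊑ τ ⊑ σ forces σ = τ.

module Submission where

open import Defs
open import Data.Bool using (Bool; true; false; T; not; _∧_; if_then_else_)
open import Data.List using (List; []; _∷_; map)
open import Data.Nat as ℕ using (ℕ; zero; suc; z≤n; s≤s)
import Data.Nat.Properties as ℕP
open import Data.Integer as ℤ
  using (ℤ; +_; -[1+_]; -_; ∣_∣; 0ℤ; _<_; _≤_; -≤-; -≤+; +≤+; -<-; -<+; +<+)
import Data.Integer.Properties as ℤP
open import Data.Product using (Σ; _×_; _,_; proj₁)
open import Data.Sum using (_⊎_; inj₁; inj₂; [_,_])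
open import Data.Empty using (⊥; ⊥-elim)
open import Function using (_∘_)
open import Relation.Binary.PropositionalEquality hiding ([_])
open import Relation.Nullary using (¬_; Dec; yes; no)
open import Relation.Nullary.Decidable using (_×-dec_; _⊎-dec_; ¬?)
open import Data.List.Relation.Unary.Any using (here; there; any?; satisfied)
open import Data.List.Membership.Propositional using (_∈_; lose)
open import Data.Nat.ListAction using (sum)
open import Data.Nat.Induction using (<-wellFounded)
open import Induction.WellFounded using (Acc; acc)
open import Relation.Binary using (tri<; tri≈; tri>)

⁺-+ : ∀ m → (+ m) ⁺ ≡ + suc m
⁺-+ m = cong +_ (ℕP.+-comm m 1)

<⁺ : ∀ c → c < c ⁺
<⁺ (+ m) rewrite ⁺-+ m = +<+ ℕP.≤-refl
<⁺ -[1+ zero ] = -<+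
<⁺ -[1+ suc m ] = -<- ℕP.≤-refl

⁺≢0 : ∀ c → c ⁺ ≢ 0ℤ
⁺≢0 (+ m) rewrite ⁺-+ m = λ ()
⁺≢0 -[1+ zero ] = λ ()
⁺≢0 -[1+ suc m ] = λ ()

⁺-adjacent : ∀ c {u} → u ≢ 0ℤ → u ≤ c ⊎ c ⁺ ≤ u
⁺-adjacent (+ m) {+ p} _ rewrite ⁺-+ m with ℕP.≤-<-connex p m
... | inj₁ p≤m = inj₁ (+≤+ p≤m)
... | inj₂ m<p = inj₂ (+≤+ m<p)
⁺-adjacent (+ m) { -[1+ p ]} _ = inj₁ -≤+
⁺-adjacent -[1+ zero ] {+ zero} u≢0 = ⊥-elim (u≢0 refl)
⁺-adjacent -[1+ zero ] {+ suc p} _ = inj₂ (+≤+ (s≤s z≤n))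
⁺-adjacent -[1+ zero ] { -[1+ p ]} _ = inj₁ (-≤- z≤n)
⁺-adjacent -[1+ suc m ] {+ p} _ = inj₂ -≤+
⁺-adjacent -[1+ suc m ] { -[1+ p ]} _ with ℕP.≤-<-connex p m
... | inj₁ p≤m = inj₂ (-≤- p≤m)
... | inj₂ m<p = inj₁ (-≤- m<p)

-⁺-⁺ : ∀ c → c ≢ 0ℤ → (- (c ⁺)) ⁺ ≡ - c
-⁺-⁺ (+ zero) c≢0 = ⊥-elim (c≢0 refl)
-⁺-⁺ (+ suc m) _ rewrite ℕP.+-comm m 1 = refl
-⁺-⁺ -[1+ zero ] _ = refl
-⁺-⁺ -[1+ suc m ] _ = ⁺-+ (suc m)

<⇒⁺≤ : ∀ {c u} → c < u → u ≢ 0ℤ → c ⁺ ≤ u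
<⇒⁺≤ {c} c<u u≢0 with ⁺-adjacent c u≢0
... | inj₁ u≤c  = ⊥-elim (ℤP.<⇒≱ c<u u≤c)
... | inj₂ c⁺≤u = c⁺≤u

neg-flip : ∀ {x y} → - x ≡ y → x ≡ - y
neg-flip {x} eq = trans (sym (ℤP.neg-involutive x)) (cong -_ eq)

neg≢self : ∀ {x} → x ≢ 0ℤ → - x ≢ x
neg≢self {+ zero} x≢0 _ = x≢0 refl
neg≢self {+ suc m} _ ()
neg≢self { -[1+ m ]} _ ()

<-neg⇒<0 : ∀ {z} → z < - z → z < 0ℤ
<-neg⇒<0 {+ zero} (+<+ ())
<-neg⇒<0 { -[1+ m ]} _ = -<+

<0⇒<-neg : ∀ {z} → z < 0ℤ → z < - z
<0⇒<-neg { -[1+ m ]} _ = -<+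
<0⇒<-neg {+ _} (+<+ ())

∣-∣-<-shrinkˡ : ∀ {lo lo′ hi} → lo < lo′ → lo′ ≤ hi → ∣ lo′ ℤ.- hi ∣ ℕ.< ∣ lo ℤ.- hi ∣
∣-∣-<-shrinkˡ {lo} {lo′} {hi} lo<lo′ lo′≤hi = ℤP.drop‿+<+ (begin-strict
  + ∣ lo′ ℤ.- hi ∣  ≡⟨ ℤP.∣-∣-≤ lo′≤hi ⟩
  hi ℤ.- lo′        <⟨ ℤP.+-monoʳ-< hi (ℤP.neg-mono-< lo<lo′) ⟩
  hi ℤ.- lo         ≡⟨ ℤP.∣-∣-≤ (ℤP.≤-trans (ℤP.<⇒≤ lo<lo′) lo′≤hi) ⟨
  + ∣ lo ℤ.- hi ∣   ∎)
  where open ℤP.≤-Reasoning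

∣-∣-<-shrinkʳ : ∀ {lo hi′ hi} → lo ≤ hi′ → hi′ < hi → ∣ lo ℤ.- hi′ ∣ ℕ.< ∣ lo ℤ.- hi ∣
∣-∣-<-shrinkʳ {lo} {hi′} {hi} lo≤hi′ hi′<hi = ℤP.drop‿+<+ (begin-strict
  + ∣ lo ℤ.- hi′ ∣  ≡⟨ ℤP.∣-∣-≤ lo≤hi′ ⟩
  hi′ ℤ.- lo        <⟨ ℤP.+-monoˡ-< (- lo) hi′<hi ⟩
  hi ℤ.- lo         ≡⟨ ℤP.∣-∣-≤ (ℤP.≤-trans lo≤hi′ (ℤP.<⇒≤ hi′<hi)) ⟨
  + ∣ lo ℤ.- hi ∣   ∎)
  where open ℤP.≤-Reasoning

⁺-crossing : (P : ℤ → Set) → (∀ v → Dec (P v)) → ∀ {lo hi} → lo ≢ 0ℤ → hi ≢ 0ℤ → lo < hi →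
             ¬ P lo → P hi → Σ ℤ λ v → v ≢ 0ℤ × lo ≤ v × v < hi × ¬ P v × P (v ⁺)
⁺-crossing P P? {lo} {hi} lo≢0 hi≢0 lo<hi ¬Plo Phi = go lo≢0 lo<hi ¬Plo (<-wellFounded _)
  where
  go : ∀ {lo} → lo ≢ 0ℤ → lo < hi → ¬ P lo → Acc ℕ._<_ ∣ lo ℤ.- hi ∣ →
       Σ ℤ λ v → v ≢ 0ℤ × lo ≤ v × v < hi × ¬ P v × P (v ⁺)
  go {lo} lo≢0 lo<hi ¬Plo (acc rs) with P? (lo ⁺)
  ... | yes Plo⁺ = lo , lo≢0 , ℤP.≤-refl , lo<hi , ¬Plo , Plo⁺
  ... | no ¬Plo⁺ =
    let lo⁺<hi = ℤP.≤∧≢⇒< (<⇒⁺≤ lo<hi hi≢0) (λ lo⁺≡hi → ¬Plo⁺ (subst P (sym lo⁺≡hi) Phi))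
        (v , v≢0 , lo⁺≤v , v<hi , ¬Pv , Pv⁺) =
          go (⁺≢0 lo) lo⁺<hi ¬Plo⁺ (rs (∣-∣-<-shrinkˡ (<⁺ lo) (ℤP.<⇒≤ lo⁺<hi)))
    in v , v≢0 , ℤP.≤-trans (ℤP.<⇒≤ (<⁺ lo)) lo⁺≤v , v<hi , ¬Pv , Pv⁺

inflationary : (D : ℤ → Set) (lo : ℤ) → (∀ {v} → D v → lo < v) →
               (h : ℤ → ℤ) → (∀ {v} → D v → D (h v)) → (∀ {u v} → D u → D v → u < v → h u < h v) →
               ∀ {v} → D v → v ≤ h v
inflationary D lo lo<D h h-into h-mono {v} v∈ = go v∈ (<-wellFounded _)
  where
  -- A descent h v < v would force the descent h (h v) < h v below it.
  go : ∀ {v} → D v → Acc ℕ._<_ ∣ lo ℤ.- v ∣ → v ≤ h v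
  go {v} v∈ (acc rs) = ℤP.≮⇒≥ λ hv<v →
    ℤP.<⇒≱ (h-mono (h-into v∈) v∈ hv<v)
           (go (h-into v∈) (rs (∣-∣-<-shrinkʳ (ℤP.<⇒≤ (lo<D (h-into v∈))) hv<v)))

-- Signed permutations and their inversions

module _ {n : ℕ} where

  InPM-neg : ∀ {x} → InPM n x → InPM n (- x)
  InPM-neg {x} (x≢0 , ∣x∣≤n) =
    x≢0 ∘ ℤP.neg-injective , subst (ℕ._≤ n) (sym (ℤP.∣-i∣≡∣i∣ x)) ∣x∣≤n

  InPM-suc : ∀ {a} → suc a ℕ.≤ n → InPM n (+ suc a)
  InPM-suc a<n = (λ ()) , a<n

  InPM-negsuc : ∀ {a} → suc a ℕ.≤ n → InPM n -[1+ a ]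
  InPM-negsuc a<n = (λ ()) , a<n

  InPM-between : ∀ {a b x} → InPM n a → InPM n b → a ≤ x → x ≤ b → x ≢ 0ℤ → InPM n x
  InPM-between {b = + p} {x = + m} _ (_ , p≤n) _ (+≤+ m≤p) x≢0 = x≢0 , ℕP.≤-trans m≤p p≤n
  InPM-between {a = -[1+ p ]} {x = -[1+ m ]} (_ , p<n) _ (-≤- m≤p) _ x≢0 = x≢0 , ℕP.≤-trans (s≤s m≤p) p<n
  InPM-between {a = + p} {x = -[1+ m ]} _ _ () _ _

  InPM-lower : ∀ {x} → InPM n x → -[1+ n ] < x
  InPM-lower {+ m} _ = -<+
  InPM-lower { -[1+ m ]} (_ , m<n) = -<- m<n

module _ {n : ℕ} (σ : SignedPerm n) where

  fun-injective : ∀ {x y} → InPM n x → InPM n y → fun σ x ≡ fun σ y → x ≡ y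
  fun-injective {x} {y} x∈ y∈ eq = begin
    x                ≡⟨ inv-fun σ x x∈ ⟨
    inv σ (fun σ x)  ≡⟨ cong (inv σ) eq ⟩
    inv σ (fun σ y)  ≡⟨ inv-fun σ y y∈ ⟩
    y                ∎
    where open ≡-Reasoning

  fun-<-or-> : ∀ {x y} → InPM n x → InPM n y → x ≢ y → fun σ x < fun σ y ⊎ fun σ y < fun σ x
  fun-<-or-> {x} {y} x∈ y∈ x≢y with ℤP.<-cmp (fun σ x) (fun σ y)
  ... | tri< lt _ _ = inj₁ lt
  ... | tri≈ _ eq _ = ⊥-elim (x≢y (fun-injective x∈ y∈ eq))
  ... | tri> _ _ gt = inj₂ gt

  mirror-< : ∀ {x y} → InPM n x → InPM n y → fun σ x < fun σ y → fun σ (- y) < fun σ (- x)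
  mirror-< {x} {y} x∈ y∈ lt rewrite odd σ x x∈ | odd σ y y∈ = ℤP.neg-mono-< lt

  <-mirror⇒<0 : ∀ {x} → InPM n x → fun σ x < fun σ (- x) → fun σ x < 0ℤ
  <-mirror⇒<0 {x} x∈ lt rewrite odd σ x x∈ = <-neg⇒<0 lt

  <0⇒<-mirror : ∀ {x} → InPM n x → fun σ x < 0ℤ → fun σ x < fun σ (- x)
  <0⇒<-mirror {x} x∈ lt rewrite odd σ x x∈ = <0⇒<-neg lt

module _ {n : ℕ} where

  record _⊑_ (σ π : SignedPerm n) : Set where
    constructor mk⊑
    field
      ⊑-inversion : ∀ {x y} → InPM n x → InPM n y → x < y → fun σ y < fun σ x → fun π y < fun π x

  open _⊑_ public

  ⊑-refl : ∀ {π} → π ⊑ π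
  ⊑-refl = mk⊑ λ _ _ _ rev → rev

  ⊑-trans : ∀ {ρ σ π} → ρ ⊑ σ → σ ⊑ π → ρ ⊑ π
  ⊑-trans ρ⊑σ σ⊑π = mk⊑ λ x∈ y∈ x<y rev → ⊑-inversion σ⊑π x∈ y∈ x<y (⊑-inversion ρ⊑σ x∈ y∈ x<y rev)

  ⊑-ascent : ∀ {σ π} → σ ⊑ π → ∀ {x y} → InPM n x → InPM n y → x < y →
             fun π x < fun π y → fun σ x < fun σ y
  ⊑-ascent {σ} σ⊑π x∈ y∈ x<y asc with fun-<-or-> σ x∈ y∈ (ℤP.<⇒≢ x<y)
  ... | inj₁ lt = lt
  ... | inj₂ rev = ⊥-elim (ℤP.<-asym asc (⊑-inversion σ⊑π x∈ y∈ x<y rev))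

  ⊆ᵢ⇒⊑ : ∀ {σ π} → σ ⊆ᵢ π → σ ⊑ π
  ⊑-inversion (⊆ᵢ⇒⊑ _) {+ zero} (0≢0 , _) _ _ _ = ⊥-elim (0≢0 refl)
  ⊑-inversion (⊆ᵢ⇒⊑ _) {y = + zero} _ (0≢0 , _) _ _ = ⊥-elim (0≢0 refl)
  ⊑-inversion (⊆ᵢ⇒⊑ _) {+ suc a} { -[1+ b ]} _ _ () _
  ⊑-inversion (⊆ᵢ⇒⊑ sub) {+ suc a} {+ suc b} _ (_ , b<n) (+<+ a<b) rev =
    let (_ , _ , _ , r) = sub (pos (suc a) (suc b)) (s≤s z≤n , a<b , b<n , rev) in r
  ⊑-inversion (⊆ᵢ⇒⊑ {σ} {π} sub) { -[1+ a ]} { -[1+ b ]} (_ , a<n) (_ , b<n) (-<- b<a) rev =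
    let (_ , _ , _ , r) = sub (pos (suc b) (suc a))
                              (s≤s z≤n , s≤s b<a , a<n , mirror-< σ (InPM-negsuc b<n) (InPM-negsuc a<n) rev)
    in mirror-< π (InPM-suc a<n) (InPM-suc b<n) r
  ⊑-inversion (⊆ᵢ⇒⊑ {σ} {π} sub) { -[1+ a ]} {+ suc b} (_ , a<n) (_ , b<n) _ rev with ℕP.<-cmp a b
  ... | tri< a<b _ _ =
    let (_ , _ , _ , r) = sub (neg (suc b) (suc a))
                              (s≤s z≤n , s≤s a<b , b<n , mirror-< σ (InPM-suc b<n) (InPM-negsuc a<n) rev)
    in mirror-< π (InPM-suc a<n) (InPM-negsuc b<n) r
  ... | tri≈ _ refl _ =
    let (_ , _ , r) = sub (bar (suc b)) (s≤s z≤n , b<n , <-mirror⇒<0 σ (InPM-suc b<n) rev)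
    in <0⇒<-mirror π (InPM-suc b<n) r
  ... | tri> _ _ b<a =
    let (_ , _ , _ , r) = sub (neg (suc a) (suc b)) (s≤s z≤n , s≤s b<a , a<n , rev) in r

  ⊑⇒⊆ᵢ : ∀ {σ π} → σ ⊑ π → σ ⊆ᵢ π
  ⊑⇒⊆ᵢ _ (bar zero) (() , _)
  ⊑⇒⊆ᵢ {σ} {π} σ⊑π (bar (suc i)) (1≤i , i≤n , σi<0) =
    1≤i , i≤n ,
    <-mirror⇒<0 π (InPM-suc i≤n)
      (⊑-inversion σ⊑π (InPM-negsuc i≤n) (InPM-suc i≤n) -<+ (<0⇒<-mirror σ (InPM-suc i≤n) σi<0))
  ⊑⇒⊆ᵢ _ (pos zero _) (() , _)
  ⊑⇒⊆ᵢ σ⊑π (pos (suc i) (suc j)) (1≤i , i<j , j≤n , rev) =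
    1≤i , i<j , j≤n ,
    ⊑-inversion σ⊑π (InPM-suc (ℕP.<⇒≤ (ℕP.<-≤-trans i<j j≤n))) (InPM-suc j≤n) (+<+ i<j) rev
  ⊑⇒⊆ᵢ _ (neg _ zero) (() , _)
  ⊑⇒⊆ᵢ σ⊑π (neg (suc j) (suc i)) (1≤i , i<j , j≤n , rev) =
    1≤i , i<j , j≤n ,
    ⊑-inversion σ⊑π (InPM-negsuc j≤n) (InPM-suc (ℕP.<⇒≤ (ℕP.<-≤-trans i<j j≤n))) -<+ rev

module _ {n : ℕ} where

  ⊑⊒⇒preserves-< : ∀ {τ ρ : SignedPerm n} → τ ⊑ ρ → ρ ⊑ τ → ∀ {x y} → InPM n x → InPM n y →
            fun τ x < fun τ y → fun ρ x < fun ρ y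
  ⊑⊒⇒preserves-< {τ} {ρ} τ⊑ρ ρ⊑τ {x} {y} x∈ y∈ τx<τy with ℤP.<-cmp x y
  ... | tri< x<y _ _ = ⊑-ascent ρ⊑τ x∈ y∈ x<y τx<τy
  ... | tri≈ _ refl _ = ⊥-elim (ℤP.<-irrefl refl τx<τy)
  ... | tri> _ _ y<x = ⊑-inversion τ⊑ρ y∈ x∈ y<x τx<τy

  ⊑⊒⇒≤ : ∀ {τ ρ : SignedPerm n} → τ ⊑ ρ → ρ ⊑ τ → ∀ {x} → InPM n x → fun τ x ≤ fun ρ x
  ⊑⊒⇒≤ {τ} {ρ} τ⊑ρ ρ⊑τ {x} x∈ =
    subst (fun τ x ≤_) (cong (fun ρ) (inv-fun τ x x∈))
      (inflationary (InPM n) -[1+ n ] InPM-lower (fun ρ ∘ inv τ)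
        (λ {v} v∈ → fun-into ρ _ (inv-into τ v v∈))
        (λ {u} {v} u∈ v∈ u<v → ⊑⊒⇒preserves-< τ⊑ρ ρ⊑τ (inv-into τ u u∈) (inv-into τ v v∈)
                                  (subst₂ _<_ (sym (fun-inv τ u u∈)) (sym (fun-inv τ v v∈)) u<v))
        (fun-into τ x x∈))

  ⊑-antisym : ∀ {τ ρ : SignedPerm n} → τ ⊑ ρ → ρ ⊑ τ → τ ≈ₚ ρ
  ⊑-antisym τ⊑ρ ρ⊑τ x x∈ = ℤP.≤-antisym (⊑⊒⇒≤ τ⊑ρ ρ⊑τ x∈) (⊑⊒⇒≤ ρ⊑τ τ⊑ρ x∈)

blk-mono : ∀ as {k k′} → k ℕ.≤ k′ → blk as k ℕ.≤ blk as k′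
blk-mono [] _ = z≤n
blk-mono (a ∷ as) {k} {k′} k≤k′ with k ℕ.≤ᵇ a in k≤ᵇa | k′ ℕ.≤ᵇ a in k′≤ᵇa
... | true  | true  = ℕP.≤-refl
... | true  | false = s≤s z≤n
... | false | true  = ⊥-elim (ℕP.<⇒≱ k>a (ℕP.≤-trans k≤k′ (ℕP.≤ᵇ⇒≤ k′ a (subst T (sym k′≤ᵇa) _))))
  where
  k>a : a ℕ.< k
  k>a = ℕP.≰⇒> (λ k≤a → subst T k≤ᵇa (ℕP.≤⇒≤ᵇ k≤a))
... | false | false = s≤s (blk-mono as (ℕP.∸-monoˡ-≤ a k≤k′))

signedBlock : List ℕ → ℤ → ℤ
signedBlock as (+ k)    = + blk as k
signedBlock as -[1+ k ] = - (+ blk as (suc k))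

signedBlock-mono : ∀ as {x y} → x ≤ y → signedBlock as x ≤ signedBlock as y
signedBlock-mono as {+ k} {+ k′} (+≤+ k≤k′) = +≤+ (blk-mono as k≤k′)
signedBlock-mono as { -[1+ k ]} {+ k′} _ = ℤP.≤-trans (ℤP.neg-mono-≤ (+≤+ z≤n)) (+≤+ z≤n)
signedBlock-mono as { -[1+ k ]} { -[1+ k′ ]} (-≤- k′≤k) = ℤP.neg-mono-≤ (+≤+ (blk-mono as (s≤s k′≤k)))

merge : Bool → ℤ → ℤ
merge s c = if not s ∧ (∣ c ∣ ℕ.≡ᵇ 1) then 0ℤ else c

merge-mono : ∀ s {c c′} → c ≤ c′ → merge s c ≤ merge s c′
merge-mono true c≤c′ = c≤c′
merge-mono false {+ 0} {+ 0} _ = ℤP.≤-refl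
merge-mono false {+ 0} {+ 1} _ = ℤP.≤-refl
merge-mono false {+ 0} {+ suc (suc _)} _ = +≤+ z≤n
merge-mono false {+ 1} {+ 1} _ = ℤP.≤-refl
merge-mono false {+ 1} {+ suc (suc _)} _ = +≤+ z≤n
merge-mono false {+ suc (suc _)} {+ suc (suc _)} c≤c′ = c≤c′
merge-mono false { -[1+ 0 ]} {+ 0} _ = ℤP.≤-refl
merge-mono false { -[1+ 0 ]} {+ 1} _ = ℤP.≤-refl
merge-mono false { -[1+ 0 ]} {+ suc (suc _)} _ = +≤+ z≤n
merge-mono false { -[1+ 0 ]} { -[1+ 0 ]} _ = ℤP.≤-refl
merge-mono false { -[1+ suc _ ]} {+ 0} _ = -≤+
merge-mono false { -[1+ suc _ ]} {+ 1} _ = -≤+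
merge-mono false { -[1+ suc _ ]} {+ suc (suc _)} _ = -≤+
merge-mono false { -[1+ suc _ ]} { -[1+ 0 ]} _ = -≤+
merge-mono false { -[1+ suc _ ]} { -[1+ suc _ ]} c≤c′ = c≤c′
merge-mono false {+ 1} {+ 0} (+≤+ ())
merge-mono false {+ suc (suc _)} {+ 0} (+≤+ ())
merge-mono false {+ suc (suc _)} {+ 1} (+≤+ (s≤s ()))
merge-mono false { -[1+ 0 ]} { -[1+ suc _ ]} (-≤- ())

module _ {n : ℕ} (α : TypeBComp n) where

  label≡merge : ∀ x → label α x ≡ merge (split α) (signedBlock (parts α) x)
  label≡merge (+ k) = refl
  label≡merge -[1+ k ] with blk (parts α) (suc k)
  ... | zero  = refl
  ... | suc b = refl

  label-mono : ∀ {x y} → x ≤ y → label α x ≤ label α y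
  label-mono {x} {y} x≤y rewrite label≡merge x | label≡merge y =
    merge-mono (split α) (signedBlock-mono (parts α) x≤y)

  label-convex : ∀ {x y z} → x ≤ y → y ≤ z → label α x ≡ label α z → label α x ≡ label α y
  label-convex {x} {y} {z} x≤y y≤z ℓx≡ℓz =
    ℤP.≤-antisym (label-mono x≤y) (subst (label α y ≤_) (sym ℓx≡ℓz) (label-mono y≤z))

  label-neg : ∀ x → x ≢ 0ℤ → label α (- x) ≡ - label α x
  label-neg (+ zero) x≢0 = ⊥-elim (x≢0 refl)
  label-neg (+ suc k) _ with not (split α) ∧ (blk (parts α) (suc k) ℕ.≡ᵇ 1)
  ... | true  = refl
  ... | false = refl
  label-neg -[1+ k ] _ with not (split α) ∧ (blk (parts α) (suc k) ℕ.≡ᵇ 1)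
  ... | true  = refl
  ... | false = sym (ℤP.neg-involutive _)

-- Exchanging two pairs of adjacent values

InPair : ℤ → ℤ → Set
InPair c v = v ≡ c ⊎ v ≡ c ⁺

module _ {c : ℤ} where

  InPair-lower : ∀ {v} → InPair c v → c ≤ v
  InPair-lower (inj₁ refl) = ℤP.≤-refl
  InPair-lower (inj₂ refl) = ℤP.<⇒≤ (<⁺ c)

  InPair-upper : ∀ {v} → InPair c v → v ≤ c ⁺
  InPair-upper (inj₁ refl) = ℤP.<⇒≤ (<⁺ c)
  InPair-upper (inj₂ refl) = ℤP.≤-refl

  ∉Pair : ∀ {w} → w ≢ 0ℤ → ¬ InPair c w → w < c ⊎ c ⁺ < w
  ∉Pair w≢0 w∉ with ⁺-adjacent c w≢0
  ... | inj₁ w≤c  = inj₁ (ℤP.≤∧≢⇒< w≤c (w∉ ∘ inj₁))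
  ... | inj₂ c⁺≤w = inj₂ (ℤP.≤∧≢⇒< c⁺≤w (w∉ ∘ inj₂ ∘ sym))

  ∉Pair-<-InPair : ∀ {u v w} → u ≢ 0ℤ → ¬ InPair c u → InPair c v → InPair c w → u < v → u < w
  ∉Pair-<-InPair u≢0 u∉ v∈ w∈ u<v with ∉Pair u≢0 u∉
  ... | inj₁ u<c  = ℤP.<-≤-trans u<c (InPair-lower w∈)
  ... | inj₂ c⁺<u = ⊥-elim (ℤP.<⇒≱ (ℤP.<-trans c⁺<u u<v) (InPair-upper v∈))

  InPair-<-∉Pair : ∀ {u v w} → v ≢ 0ℤ → ¬ InPair c v → InPair c u → InPair c w → u < v → w < v
  InPair-<-∉Pair v≢0 v∉ u∈ w∈ u<v with ∉Pair v≢0 v∉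
  ... | inj₁ v<c  = ⊥-elim (ℤP.<⇒≱ (ℤP.<-trans u<v v<c) (InPair-lower u∈))
  ... | inj₂ c⁺<v = ℤP.≤-<-trans (InPair-upper w∈) c⁺<v

  InPair-< : ∀ {u v} → InPair c u → InPair c v → u < v → u ≡ c × v ≡ c ⁺
  InPair-< (inj₁ refl) (inj₁ refl) u<v = ⊥-elim (ℤP.<-irrefl refl u<v)
  InPair-< (inj₁ refl) (inj₂ refl) _   = refl , refl
  InPair-< (inj₂ refl) (inj₁ refl) u<v = ⊥-elim (ℤP.<-asym u<v (<⁺ c))
  InPair-< (inj₂ refl) (inj₂ refl) u<v = ⊥-elim (ℤP.<-irrefl refl u<v)

-- Exchanges a ↔ a ⁺ and - a ⁺ ↔ - a; for a = -1 these two exchanges coincide.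
exchange : ℤ → ℤ → ℤ
exchange a v with v ℤ.≟ a | v ℤ.≟ a ⁺ | v ℤ.≟ - (a ⁺) | v ℤ.≟ - a
... | yes _ | _     | _     | _     = a ⁺
... | no _  | yes _ | _     | _     = a
... | no _  | no _  | yes _ | _     = - a
... | no _  | no _  | no _  | yes _ = - (a ⁺)
... | no _  | no _  | no _  | no _  = v

module Exchange (a : ℤ) (a≢0 : a ≢ 0ℤ) where

  b : ℤ
  b = a ⁺

  b≢a : b ≢ a
  b≢a b≡a = ℤP.<-irrefl (sym b≡a) (<⁺ a)

  -b⁺≡-a : (- b) ⁺ ≡ - a
  -b⁺≡-a = -⁺-⁺ a a≢0

  data View (v w : ℤ) : Set where
    a↦b   : v ≡ a → w ≡ b → View v w
    b↦a   : v ≡ b → v ≢ a → w ≡ a → View v w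
    -b↦-a : v ≡ - b → ¬ InPair a v → w ≡ - a → View v w
    -a↦-b : v ≡ - a → ¬ InPair a v → v ≢ - b → w ≡ - b → View v w
    fixed  : ¬ InPair a v → v ≢ - b → v ≢ - a → w ≡ v → View v w

  view : ∀ v → View v (exchange a v)
  view v with v ℤ.≟ a | v ℤ.≟ b | v ℤ.≟ - b | v ℤ.≟ - a
  ... | yes v≡a | _       | _        | _        = a↦b v≡a refl
  ... | no v≢a  | yes v≡b | _        | _        = b↦a v≡b v≢a refl
  ... | no v≢a  | no v≢b  | yes v≡-b | _        = -b↦-a v≡-b [ v≢a , v≢b ] refl
  ... | no v≢a  | no v≢b  | no v≢-b  | yes v≡-a = -a↦-b v≡-a [ v≢a , v≢b ] v≢-b refl
  ... | no v≢a  | no v≢b  | no v≢-b  | no v≢-a  = fixed [ v≢a , v≢b ] v≢-b v≢-a refl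

  exchange-a : exchange a a ≡ b
  exchange-a with view a
  ... | a↦b _ eq         = eq
  ... | b↦a _ a≢a _      = ⊥-elim (a≢a refl)
  ... | -b↦-a _ a∉ _     = ⊥-elim (a∉ (inj₁ refl))
  ... | -a↦-b _ a∉ _ _   = ⊥-elim (a∉ (inj₁ refl))
  ... | fixed a∉ _ _ _    = ⊥-elim (a∉ (inj₁ refl))

  exchange-b : exchange a b ≡ a
  exchange-b with view b
  ... | a↦b b≡a _        = ⊥-elim (b≢a b≡a)
  ... | b↦a _ _ eq       = eq
  ... | -b↦-a _ b∉ _     = ⊥-elim (b∉ (inj₂ refl))
  ... | -a↦-b _ b∉ _ _   = ⊥-elim (b∉ (inj₂ refl))
  ... | fixed b∉ _ _ _    = ⊥-elim (b∉ (inj₂ refl))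

  exchange--a : exchange a (- a) ≡ - b
  exchange--a with view (- a)
  ... | a↦b -a≡a _       = ⊥-elim (neg≢self a≢0 -a≡a)
  ... | b↦a -a≡b _ _     = trans (cong (exchange a) -a≡b) (trans exchange-b (neg-flip -a≡b))
  ... | -b↦-a -a≡-b _ _  = ⊥-elim (b≢a (ℤP.neg-injective (sym -a≡-b)))
  ... | -a↦-b _ _ _ eq   = eq
  ... | fixed _ _ -a≢-a _ = ⊥-elim (-a≢-a refl)

  exchange--b : exchange a (- b) ≡ - a
  exchange--b with view (- b)
  ... | a↦b -b≡a _       = trans (cong (exchange a) -b≡a) (trans exchange-a (neg-flip -b≡a))
  ... | b↦a -b≡b _ _     = ⊥-elim (neg≢self (⁺≢0 a) -b≡b)
  ... | -b↦-a _ _ eq     = eq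
  ... | -a↦-b -b≡-a _ _ _ = ⊥-elim (b≢a (ℤP.neg-injective -b≡-a))
  ... | fixed _ -b≢-b _ _ = ⊥-elim (-b≢-b refl)

  exchange-involutive : ∀ v → exchange a (exchange a v) ≡ v
  exchange-involutive v with view v
  ... | a↦b refl eq       = trans (cong (exchange a) eq) exchange-b
  ... | b↦a refl _ eq     = trans (cong (exchange a) eq) exchange-a
  ... | -b↦-a refl _ eq   = trans (cong (exchange a) eq) exchange--a
  ... | -a↦-b refl _ _ eq = trans (cong (exchange a) eq) exchange--b
  ... | fixed _ _ _ eq    = trans (cong (exchange a) eq) eq

  exchange-odd : ∀ v → exchange a (- v) ≡ - exchange a v
  exchange-odd v with view v
  ... | a↦b refl eq       = trans exchange--a (cong -_ (sym eq))
  ... | b↦a refl _ eq     = trans exchange--b (cong -_ (sym eq))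
  ... | -b↦-a refl _ eq   = trans (cong (exchange a) (ℤP.neg-involutive b))
                                  (trans exchange-b (trans (sym (ℤP.neg-involutive a)) (cong -_ (sym eq))))
  ... | -a↦-b refl _ _ eq = trans (cong (exchange a) (ℤP.neg-involutive a))
                                  (trans exchange-a (trans (sym (ℤP.neg-involutive b)) (cong -_ (sym eq))))
  ... | fixed v∉ v≢-b v≢-a eq with view (- v)
  ...   | a↦b -v≡a _       = ⊥-elim (v≢-a (neg-flip -v≡a))
  ...   | b↦a -v≡b _ _     = ⊥-elim (v≢-b (neg-flip -v≡b))
  ...   | -b↦-a -v≡-b _ _  = ⊥-elim (v∉ (inj₂ (ℤP.neg-injective -v≡-b)))
  ...   | -a↦-b -v≡-a _ _ _ = ⊥-elim (v∉ (inj₁ (ℤP.neg-injective -v≡-a)))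
  ...   | fixed _ _ _ eq′   = trans eq′ (cong -_ (sym eq))

  exchange-InPM : ∀ {n v} → InPM n a → InPM n b → InPM n v → InPM n (exchange a v)
  exchange-InPM {n} {v} a∈ b∈ v∈ with view v
  ... | a↦b _ eq       = subst (InPM n) (sym eq) b∈
  ... | b↦a _ _ eq     = subst (InPM n) (sym eq) a∈
  ... | -b↦-a _ _ eq   = subst (InPM n) (sym eq) (InPM-neg a∈)
  ... | -a↦-b _ _ _ eq = subst (InPM n) (sym eq) (InPM-neg b∈)
  ... | fixed _ _ _ eq  = subst (InPM n) (sym eq) v∈

  data PairView (v w : ℤ) : Set where
    in-pair    : InPair a v → InPair a w → PairView v w
    in-mirror   : ¬ InPair a v → InPair (- b) v → InPair (- b) w → PairView v w
    outside : ¬ InPair a v → ¬ InPair (- b) v → w ≡ v → PairView v w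

  pairView : ∀ v → PairView v (exchange a v)
  pairView v with view v
  ... | a↦b v≡a w≡b           = in-pair (inj₁ v≡a) (inj₂ w≡b)
  ... | b↦a v≡b _ w≡a         = in-pair (inj₂ v≡b) (inj₁ w≡a)
  ... | -b↦-a v≡-b v∉ w≡-a    = in-mirror v∉ (inj₁ v≡-b) (inj₂ (trans w≡-a (sym -b⁺≡-a)))
  ... | -a↦-b v≡-a v∉ _ w≡-b  = in-mirror v∉ (inj₂ (trans v≡-a (sym -b⁺≡-a))) (inj₁ w≡-b)
  ... | fixed v∉ v≢-b v≢-a eq = outside v∉ [ v≢-b , v≢-a ∘ (λ v≡ → trans v≡ -b⁺≡-a) ] eq

  data Sides : Set where
    a-positive : (∀ {x} → InPair a x → 0ℤ < x) → (∀ {y} → InPair (- b) y → y < 0ℤ) → Sides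
    a-negative : (∀ {x} → InPair a x → x < 0ℤ) → (∀ {y} → InPair (- b) y → 0ℤ < y) → Sides
    coincide   : (∀ {y} → InPair (- b) y → InPair a y) → Sides

  sides : Sides
  sides = go a a≢0 refl
    where
    go : ∀ c → c ≢ 0ℤ → c ≡ a → Sides
    go (+ zero) c≢0 _ = ⊥-elim (c≢0 refl)
    go (+ suc m) _ refl =
      a-positive (λ x∈ → ℤP.<-≤-trans (+<+ (s≤s z≤n)) (InPair-lower x∈))
                 (λ y∈ → ℤP.≤-<-trans (subst (_ ≤_) -b⁺≡-a (InPair-upper y∈)) -<+)
    go -[1+ zero ] _ refl = coincide (λ y∈ → y∈)
    go -[1+ suc m ] _ refl =
      a-negative (λ x∈ → ℤP.≤-<-trans (InPair-upper x∈) -<+)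
                 (λ y∈ → ℤP.<-≤-trans (+<+ (s≤s z≤n)) (InPair-lower y∈))

  exchange-mono : ∀ {u v} → u ≢ 0ℤ → v ≢ 0ℤ → u < v →
                  ¬ (u ≡ a × v ≡ b) → ¬ (u ≡ - b × v ≡ - a) → exchange a u < exchange a v
  exchange-mono {u} {v} u≢0 v≢0 u<v ≢ab ≢-b-a with pairView u | pairView v
  ... | outside _ _ eu     | outside _ _ ev     = subst₂ _<_ (sym eu) (sym ev) u<v
  ... | outside u∉ _ eu    | in-pair v∈ w∈      = subst (_< _) (sym eu) (∉Pair-<-InPair u≢0 u∉ v∈ w∈ u<v)
  ... | outside _ u∉ eu    | in-mirror _ v∈ w∈  = subst (_< _) (sym eu) (∉Pair-<-InPair u≢0 u∉ v∈ w∈ u<v)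
  ... | in-pair u∈ w∈      | outside v∉ _ ev    = subst (_ <_) (sym ev) (InPair-<-∉Pair v≢0 v∉ u∈ w∈ u<v)
  ... | in-mirror _ u∈ w∈  | outside _ v∉ ev    = subst (_ <_) (sym ev) (InPair-<-∉Pair v≢0 v∉ u∈ w∈ u<v)
  ... | in-pair u∈ _       | in-pair v∈ _       = ⊥-elim (≢ab (InPair-< u∈ v∈ u<v))
  ... | in-mirror _ u∈ _   | in-mirror _ v∈ _   =
    let (u≡-b , v≡-b⁺) = InPair-< u∈ v∈ u<v in ⊥-elim (≢-b-a (u≡-b , trans v≡-b⁺ -b⁺≡-a))
  ... | in-pair u∈ wu∈     | in-mirror v∉ v∈ wv∈ with sides
  ...   | a-positive P>0 Q<0 = ⊥-elim (ℤP.<-asym u<v (ℤP.<-trans (Q<0 v∈) (P>0 u∈)))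
  ...   | a-negative P<0 Q>0 = ℤP.<-trans (P<0 wu∈) (Q>0 wv∈)
  ...   | coincide Q⊆P       = ⊥-elim (v∉ (Q⊆P v∈))
  exchange-mono _ _ u<v _ _ | in-mirror u∉ u∈ wu∈ | in-pair v∈ wv∈ with sides
  ...   | a-positive P>0 Q<0 = ℤP.<-trans (Q<0 wu∈) (P>0 wv∈)
  ...   | a-negative P<0 Q>0 = ⊥-elim (ℤP.<-asym u<v (ℤP.<-trans (P<0 v∈) (Q>0 u∈)))
  ...   | coincide Q⊆P       = ⊥-elim (u∉ (Q⊆P u∈))

module Untangle {n : ℕ} (π : SignedPerm n) {i k : ℤ} (i∈ : InPM n i) (k∈ : InPM n k)
                (i<k : i < k) (πi≡πk⁺ : fun π i ≡ fun π k ⁺) where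

  a : ℤ
  a = fun π k

  a∈ : InPM n a
  a∈ = fun-into π k k∈

  open Exchange a (proj₁ a∈)

  b∈ : InPM n b
  b∈ = subst (InPM n) πi≡πk⁺ (fun-into π i i∈)

  untangled : SignedPerm n
  untangled = record
    { fun      = exchange a ∘ fun π
    ; inv      = inv π ∘ exchange a
    ; fun-into = λ x x∈ → exchange-InPM a∈ b∈ (fun-into π x x∈)
    ; inv-into = λ y y∈ → inv-into π _ (exchange-InPM a∈ b∈ y∈)
    ; inv-fun  = λ x x∈ → trans (cong (inv π) (exchange-involutive (fun π x))) (inv-fun π x x∈)
    ; fun-inv  = λ y y∈ → trans (cong (exchange a) (fun-inv π _ (exchange-InPM a∈ b∈ y∈)))
                                (exchange-involutive y)
    ; odd      = λ x x∈ → trans (cong (exchange a) (odd π x x∈)) (exchange-odd (fun π x))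
    }

  untangled-i : fun untangled i ≡ a
  untangled-i = trans (cong (exchange a) πi≡πk⁺) exchange-b

  untangled-k : fun untangled k ≡ b
  untangled-k = exchange-a

  untangled-preserves-< : ∀ {x y} → InPM n x → InPM n y → fun π x < fun π y →
                          ¬ (x ≡ k × y ≡ i) → ¬ (x ≡ - i × y ≡ - k) →
                          fun untangled x < fun untangled y
  untangled-preserves-< {x} {y} x∈ y∈ πx<πy ≢ki ≢-i-k =
    exchange-mono (proj₁ (fun-into π x x∈)) (proj₁ (fun-into π y y∈)) πx<πy
      (λ (πx≡a , πy≡b) → ≢ki (fun-injective π x∈ k∈ πx≡a ,
                              fun-injective π y∈ i∈ (trans πy≡b (sym πi≡πk⁺))))
      (λ (πx≡-b , πy≡-a) → ≢-i-k (fun-injective π x∈ (InPM-neg i∈) (trans πx≡-b (sym π-i≡-b)) ,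
                                  fun-injective π y∈ (InPM-neg k∈) (trans πy≡-a (sym (odd π k k∈)))))
    where
    π-i≡-b : fun π (- i) ≡ - b
    π-i≡-b = trans (odd π i i∈) (cong -_ πi≡πk⁺)

  not-k-i : ∀ {x y} → x < y → ¬ (x ≡ k × y ≡ i)
  not-k-i x<y (refl , refl) = ℤP.<-asym i<k x<y

  not--i--k : ∀ {x y} → x < y → ¬ (x ≡ - i × y ≡ - k)
  not--i--k x<y (refl , refl) = ℤP.<-asym i<k (ℤP.neg-cancel-< x<y)

  untangled⊑π : untangled ⊑ π
  ⊑-inversion untangled⊑π {x} {y} x∈ y∈ x<y rev with fun-<-or-> π y∈ x∈ (ℤP.<⇒≢ x<y ∘ sym)
  ... | inj₁ πy<πx = πy<πx
  ... | inj₂ πx<πy = ⊥-elim (ℤP.<-asym rev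
                       (untangled-preserves-< x∈ y∈ πx<πy (not-k-i x<y) (not--i--k x<y)))

  ⊑untangled : ∀ {σ} → σ ⊑ π → fun σ i < fun σ k → σ ⊑ untangled
  ⊑untangled {σ} σ⊑π σi<σk = mk⊑ λ x∈ y∈ x<y rev →
    untangled-preserves-< y∈ x∈ (⊑-inversion σ⊑π x∈ y∈ x<y rev)
      (λ { (refl , refl) → ℤP.<-asym σi<σk rev })
      (λ { (refl , refl) → ℤP.<-asym (mirror-< σ i∈ k∈ σi<σk) rev })

  untangled-InQuot : ∀ α → InQuot α π → label α i ≢ label α k → InQuot α untangled
  untangled-InQuot α π∈ ℓi≢ℓk x y x∈ y∈ ℓx≡ℓy x<y =
    untangled-preserves-< x∈ y∈ (π∈ x y x∈ y∈ ℓx≡ℓy x<y) (not-k-i x<y)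
      (λ { (refl , refl) → ℓi≢ℓk (ℤP.neg-injective (begin
          - label α i    ≡⟨ label-neg α i (proj₁ i∈) ⟨
          label α (- i)  ≡⟨ ℓx≡ℓy ⟩
          label α (- k)  ≡⟨ label-neg α k (proj₁ k∈) ⟩
          - label α k    ∎)) })
    where open ≡-Reasoning

signedRange : ℕ → List ℤ
signedRange zero    = []
signedRange (suc n) = + suc n ∷ -[1+ n ] ∷ signedRange n

∈-signedRange : ∀ {n x} → InPM n x → x ∈ signedRange n
∈-signedRange {n} {+ zero} (0≢0 , _) = ⊥-elim (0≢0 refl)
∈-signedRange {suc n} {+ suc m} (_ , m<n+1) with ℕP.m≤n⇒m<n∨m≡n m<n+1
... | inj₂ refl = here refl
... | inj₁ (s≤s m<n) = there (there (∈-signedRange ((λ ()) , m<n)))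
∈-signedRange {suc n} { -[1+ m ]} (_ , m<n+1) with ℕP.m≤n⇒m<n∨m≡n m<n+1
... | inj₂ refl = there (here refl)
... | inj₁ (s≤s m<n) = there (there (∈-signedRange ((λ ()) , m<n)))

signedRange-InPM : ∀ {n x} → x ∈ signedRange n → InPM n x
signedRange-InPM {suc n} (here refl)         = (λ ()) , ℕP.≤-refl
signedRange-InPM {suc n} (there (here refl)) = (λ ()) , ℕP.≤-refl
signedRange-InPM {suc n} (there (there x∈)) =
  let (x≢0 , ∣x∣≤n) = signedRange-InPM x∈ in x≢0 , ℕP.m≤n⇒m≤1+n ∣x∣≤n

sumOver : List ℤ → (ℤ → ℕ) → ℕ
sumOver xs f = sum (map f xs)

sumOver-mono : ∀ xs {f g} → (∀ {x} → x ∈ xs → f x ℕ.≤ g x) → sumOver xs f ℕ.≤ sumOver xs g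
sumOver-mono []       _   = z≤n
sumOver-mono (x ∷ xs) f≤g = ℕP.+-mono-≤ (f≤g (here refl)) (sumOver-mono xs (f≤g ∘ there))

sumOver-mono-< : ∀ xs {f g} → (∀ {x} → x ∈ xs → f x ℕ.≤ g x) →
                 ∀ {x₀} → x₀ ∈ xs → f x₀ ℕ.< g x₀ → sumOver xs f ℕ.< sumOver xs g
sumOver-mono-< (x ∷ xs) f≤g (here refl) fx<gx = ℕP.+-mono-<-≤ fx<gx (sumOver-mono xs (f≤g ∘ there))
sumOver-mono-< (x ∷ xs) f≤g (there x₀∈) fx₀<gx₀ =
  ℕP.+-mono-≤-< (f≤g (here refl)) (sumOver-mono-< xs (f≤g ∘ there) x₀∈ fx₀<gx₀)

indicator : ∀ {P : Set} → Dec P → ℕ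
indicator (yes _) = 1
indicator (no _)  = 0

indicator-mono : ∀ {P Q : Set} (p : Dec P) (q : Dec Q) → (P → Q) → indicator p ℕ.≤ indicator q
indicator-mono (yes p) (yes _) _   = ℕP.≤-refl
indicator-mono (yes p) (no ¬q) P⇒Q = ⊥-elim (¬q (P⇒Q p))
indicator-mono (no _)  _       _   = z≤n

indicator-mono-< : ∀ {P Q : Set} (p : Dec P) (q : Dec Q) → ¬ P → Q → indicator p ℕ.< indicator q
indicator-mono-< (yes p) _       ¬p _ = ⊥-elim (¬p p)
indicator-mono-< (no _)  (yes _) _  _ = s≤s z≤n
indicator-mono-< (no _)  (no ¬q) _  q = ⊥-elim (¬q q)

module _ {n : ℕ} where

  IsInversion : SignedPerm n → ℤ → ℤ → Set
  IsInversion τ x y = x < y × fun τ y < fun τ x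

  inversion? : ∀ τ x y → Dec (IsInversion τ x y)
  inversion? τ x y = (x ℤ.<? y) ×-dec (fun τ y ℤ.<? fun τ x)

  inversionCount : SignedPerm n → ℕ
  inversionCount τ =
    sumOver (signedRange n) λ x → sumOver (signedRange n) λ y → indicator (inversion? τ x y)

  ⊑⇒inversionCount-< : ∀ {σ π} → σ ⊑ π → ∀ {i k} → InPM n i → InPM n k →
                       ¬ IsInversion σ i k → IsInversion π i k → inversionCount σ ℕ.< inversionCount π
  ⊑⇒inversionCount-< {σ} {π} σ⊑π i∈ k∈ ¬rev rev =
    sumOver-mono-< (signedRange n) (λ x∈ → sumOver-mono (signedRange n) (λ y∈ → pointwise x∈ y∈))
      (∈-signedRange i∈)
      (sumOver-mono-< (signedRange n) (pointwise (∈-signedRange i∈)) (∈-signedRange k∈)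
        (indicator-mono-< (inversion? σ _ _) (inversion? π _ _) ¬rev rev))
    where
    pointwise : ∀ {x y} → x ∈ signedRange n → y ∈ signedRange n →
                indicator (inversion? σ x y) ℕ.≤ indicator (inversion? π x y)
    pointwise x∈ y∈ = indicator-mono (inversion? σ _ _) (inversion? π _ _)
      (λ (x<y , rev) → x<y , ⊑-inversion σ⊑π (signedRange-InPM x∈) (signedRange-InPM y∈) x<y rev)

-- Patterns

module _ {n : ℕ} (α : TypeBComp n) where

  -- Pattern312 α π i j k unfolds to PatternWith α π i j k C for the condition C chosen by split α.
  PatternWith : SignedPerm n → ℤ → ℤ → ℤ → Set → Set
  PatternWith π i j k C =
    InPM n i × InPM n j × InPM n k × i < j × j < k ×
    label α i ≢ label α j × label α j ≢ label α k × label α i ≢ label α k ×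
    0ℤ < j × fun π i ≡ (fun π k) ⁺ × C

  mapCondition : ∀ {π i j k C D} → (C → D) → PatternWith π i j k C → PatternWith π i j k D
  mapCondition f (i∈ , j∈ , k∈ , i<j , j<k , ℓij , ℓjk , ℓik , 0<j , πi≡πk⁺ , c) =
    i∈ , j∈ , k∈ , i<j , j<k , ℓij , ℓjk , ℓik , 0<j , πi≡πk⁺ , f c

-- σ k < σ i sit at positions k > j > i, so between them lie consecutive values v < v ⁺ at
-- positions q > j > p; then (p, j, q) is a pattern of σ.
reflect : ∀ {n} {α : TypeBComp n} {π σ : SignedPerm n} {i j k C} → InQuot α σ → σ ⊑ π →
          PatternWith α π i j k C → fun σ k < fun σ i →
          Σ ℤ λ p → Σ ℤ λ q → PatternWith α σ p j q (fun σ k ≤ fun σ q × fun σ p ≤ fun σ i)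
reflect {n} {α} {π} {σ} {i} {j} {k} σ∈ σ⊑π
        (i∈ , j∈ , k∈ , i<j , j<k , ℓi≢ℓj , ℓj≢ℓk , _ , 0<j , πi≡πk⁺ , _) σk<σi
  with ⁺-crossing (λ v → inv σ v < j) (λ v → inv σ v ℤ.<? j)
         (proj₁ (fun-into σ k k∈)) (proj₁ (fun-into σ i i∈)) σk<σi σk-after σi-before
  where
  σk-after : ¬ (inv σ (fun σ k) < j)
  σk-after k<j = ℤP.<-asym j<k (subst (_< j) (inv-fun σ k k∈) k<j)
  σi-before : inv σ (fun σ i) < j
  σi-before = subst (_< j) (sym (inv-fun σ i i∈)) i<j
... | v , v≢0 , σk≤v , v<σi , q≮j , p<j =
  p , q , p∈ , j∈ , q∈ , p<j , j<q , ℓp≢ℓj , ℓj≢ℓq , ℓp≢ℓq , 0<j , σp≡σq⁺ , σk≤σq , σp≤σi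
  where
  σk∈ : InPM n (fun σ k)
  σk∈ = fun-into σ k k∈
  σi∈ : InPM n (fun σ i)
  σi∈ = fun-into σ i i∈
  v⁺≤σi : v ⁺ ≤ fun σ i
  v⁺≤σi = <⇒⁺≤ v<σi (proj₁ σi∈)
  σk≤v⁺ : fun σ k ≤ v ⁺
  σk≤v⁺ = ℤP.≤-trans σk≤v (ℤP.<⇒≤ (<⁺ v))
  v∈ : InPM n v
  v∈ = InPM-between σk∈ σi∈ σk≤v (ℤP.<⇒≤ v<σi) v≢0
  v⁺∈ : InPM n (v ⁺)
  v⁺∈ = InPM-between σk∈ σi∈ σk≤v⁺ v⁺≤σi (⁺≢0 v)

  p q : ℤ
  p = inv σ (v ⁺)
  q = inv σ v
  p∈ : InPM n p
  p∈ = inv-into σ _ v⁺∈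
  q∈ : InPM n q
  q∈ = inv-into σ _ v∈
  σp≡v⁺ : fun σ p ≡ v ⁺
  σp≡v⁺ = fun-inv σ _ v⁺∈
  σq≡v : fun σ q ≡ v
  σq≡v = fun-inv σ _ v∈

  σk≤σq : fun σ k ≤ fun σ q
  σk≤σq = subst (_ ≤_) (sym σq≡v) σk≤v
  σq≤σi : fun σ q ≤ fun σ i
  σq≤σi = subst (_≤ _) (sym σq≡v) (ℤP.<⇒≤ v<σi)
  σk≤σp : fun σ k ≤ fun σ p
  σk≤σp = subst (_ ≤_) (sym σp≡v⁺) σk≤v⁺
  σp≤σi : fun σ p ≤ fun σ i
  σp≤σi = subst (_≤ _) (sym σp≡v⁺) v⁺≤σi

  -- π i = π k ⁺ is adjacent to π k, so each position strictly between i and k is sent by π,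
  -- and hence by σ, below k or above i.
  outside : ∀ {m} → InPM n m → i < m → m < k → fun σ m < fun σ k ⊎ fun σ i < fun σ m
  outside {m} m∈ i<m m<k with fun-<-or-> π m∈ k∈ (ℤP.<⇒≢ m<k)
  ... | inj₁ πm<πk = inj₁ (⊑-ascent σ⊑π m∈ k∈ m<k πm<πk)
  ... | inj₂ πk<πm = inj₂ (⊑-ascent σ⊑π i∈ m∈ i<m πi<πm)
    where
    πi<πm : fun π i < fun π m
    πi<πm = ℤP.≤∧≢⇒< (subst (_≤ _) (sym πi≡πk⁺) (<⇒⁺≤ πk<πm (proj₁ (fun-into π m m∈))))
                     (ℤP.<⇒≢ i<m ∘ fun-injective π i∈ m∈)

  not-between : ∀ {m} → InPM n m → i < m → m < k → fun σ k ≤ fun σ m → fun σ m ≤ fun σ i → ⊥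
  not-between m∈ i<m m<k σk≤σm σm≤σi with outside m∈ i<m m<k
  ... | inj₁ σm<σk = ℤP.<⇒≱ σm<σk σk≤σm
  ... | inj₂ σi<σm = ℤP.<⇒≱ σi<σm σm≤σi

  j<q : j < q
  j<q = ℤP.≤∧≢⇒< (ℤP.≮⇒≥ q≮j) λ where refl → not-between j∈ i<j j<k σk≤σq σq≤σi

  k≤q : k ≤ q
  k≤q = ℤP.≮⇒≥ λ q<k → not-between q∈ (ℤP.<-trans i<j j<q) q<k σk≤σq σq≤σi

  p≤i : p ≤ i
  p≤i = ℤP.≮⇒≥ λ i<p → not-between p∈ i<p (ℤP.<-trans p<j j<k) σk≤σp σp≤σi

  ℓp≢ℓj : label α p ≢ label α j
  ℓp≢ℓj ℓp≡ℓj = ℓi≢ℓj (trans (sym (label-convex α p≤i (ℤP.<⇒≤ i<j) ℓp≡ℓj)) ℓp≡ℓj)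

  ℓj≢ℓq : label α j ≢ label α q
  ℓj≢ℓq ℓj≡ℓq = ℓj≢ℓk (label-convex α (ℤP.<⇒≤ j<k) k≤q ℓj≡ℓq)

  σq<σp : fun σ q < fun σ p
  σq<σp = subst₂ _<_ (sym σq≡v) (sym σp≡v⁺) (<⁺ v)

  ℓp≢ℓq : label α p ≢ label α q
  ℓp≢ℓq ℓp≡ℓq = ℤP.<-asym σq<σp (σ∈ p q p∈ q∈ ℓp≡ℓq (ℤP.<-trans p<j j<q))

  σp≡σq⁺ : fun σ p ≡ fun σ q ⁺
  σp≡σq⁺ = trans σp≡v⁺ (cong _⁺ (sym σq≡v))

reflected-pattern : ∀ {n} {α : TypeBComp n} {π σ : SignedPerm n} {i j k} → InQuot α σ → σ ⊑ π →
                    Pattern312 α π i j k → fun σ k < fun σ i → Σ ℤ λ p → Σ ℤ λ q → Pattern312 α σ p j q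
reflected-pattern {α = record { split = true }} {σ = σ} {j = j} {k = k} σ∈ σ⊑π
                  pat@(_ , j∈ , k∈ , _ , j<k , _ , _ , _ , _ , _ , πj<πk) σk<σi =
  let (p , q , shape) = reflect σ∈ σ⊑π pat σk<σi in
  p , q , mapCondition _ {π = σ} (λ (σk≤σq , _) → ℤP.<-≤-trans σj<σk σk≤σq) shape
  where
  σj<σk : fun σ j < fun σ k
  σj<σk = ⊑-ascent σ⊑π j∈ k∈ j<k πj<πk
reflected-pattern {α = record { split = false }} {σ = σ} {j = j} {k = k} σ∈ σ⊑π
                  pat@(_ , j∈ , k∈ , _ , j<k , _ , _ , _ , _ , _ , inj₁ (α₁<j , πj<πk)) σk<σi =
  let (p , q , shape) = reflect σ∈ σ⊑π pat σk<σi in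
  p , q , mapCondition _ {π = σ} (λ (σk≤σq , _) → inj₁ (α₁<j , ℤP.<-≤-trans σj<σk σk≤σq)) shape
  where
  σj<σk : fun σ j < fun σ k
  σj<σk = ⊑-ascent σ⊑π j∈ k∈ j<k πj<πk
reflected-pattern {α = record { split = false }} {σ = σ} {i} {j} σ∈ σ⊑π
                  pat@(i∈ , j∈ , _ , i<j , _ , _ , _ , _ , _ , _ , inj₂ (j≤α₁ , πi<πj)) σk<σi =
  let (p , q , shape) = reflect σ∈ σ⊑π pat σk<σi in
  p , q , mapCondition _ {π = σ} (λ (_ , σp≤σi) → inj₂ (j≤α₁ , ℤP.≤-<-trans σp≤σi σi<σj)) shape
  where
  σi<σj : fun σ i < fun σ j
  σi<σj = ⊑-ascent σ⊑π i∈ j∈ i<j πi<πj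

pattern-ordered : ∀ {n} {α : TypeBComp n} {π σ : SignedPerm n} {i j k} → InQuot α σ → Avoid312 α σ →
                  σ ⊑ π → Pattern312 α π i j k → fun σ i < fun σ k
pattern-ordered {σ = σ} σ∈ σ-avoids σ⊑π pat@(i∈ , _ , k∈ , i<j , j<k , _)
  with fun-<-or-> σ i∈ k∈ (ℤP.<⇒≢ (ℤP.<-trans i<j j<k))
... | inj₁ σi<σk = σi<σk
... | inj₂ σk<σi = let (p , q , pat′) = reflected-pattern σ∈ σ⊑π pat σk<σi in
                   ⊥-elim (σ-avoids p _ q pat′)

module _ {n : ℕ} (α : TypeBComp n) (π : SignedPerm n) where

  patternWith? : ∀ {i j k C} → Dec C → Dec (PatternWith α π i j k C)
  patternWith? {i} {j} {k} C? =
    InPM? i ×-dec InPM? j ×-dec InPM? k ×-dec i ℤ.<? j ×-dec j ℤ.<? k ×-dec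
    ¬? (label α i ℤ.≟ label α j) ×-dec ¬? (label α j ℤ.≟ label α k) ×-dec ¬? (label α i ℤ.≟ label α k) ×-dec
    0ℤ ℤ.<? j ×-dec fun π i ℤ.≟ fun π k ⁺ ×-dec C?
    where
    InPM? : ∀ x → Dec (InPM n x)
    InPM? x = ¬? (x ℤ.≟ 0ℤ) ×-dec ∣ x ∣ ℕ.≤? n

pattern? : ∀ {n} (α : TypeBComp n) π i j k → Dec (Pattern312 α π i j k)
pattern? α@(record { split = true }) π i j k = patternWith? α π (fun π j ℤ.<? fun π k)
pattern? α@(record { split = false }) π i j k =
  patternWith? α π ((+ first (parts α) ℤ.<? j ×-dec fun π j ℤ.<? fun π k) ⊎-dec
                    (j ℤ.≤? + first (parts α) ×-dec fun π i ℤ.<? fun π j))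

pattern-search : ∀ {n} (α : TypeBComp n) π →
                 Avoid312 α π ⊎ Σ ℤ λ i → Σ ℤ λ j → Σ ℤ λ k → Pattern312 α π i j k
pattern-search {n} α π
  with any? (λ i → any? (λ j → any? (λ k → pattern? α π i j k) range) range) range
  where
  range : List ℤ
  range = signedRange n
... | yes found =
  let (i , found-j) = satisfied found
      (j , found-k) = satisfied found-j
      (k , pat)     = satisfied found-k
  in inj₂ (i , j , k , pat)
... | no none = inj₁ λ i j k pat@(i∈ , j∈ , k∈ , _) →
  none (lose (∈-signedRange i∈) (lose (∈-signedRange j∈) (lose (∈-signedRange k∈) pat)))

-- The greatest element of 𝔥_α(312) below π

module _ {n : ℕ} (α : TypeBComp n) where

  Below : SignedPerm n → SignedPerm n → Set
  Below π σ = InQuot α σ × Avoid312 α σ × σ ⊑ π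

  Greatest : SignedPerm n → SignedPerm n → Set
  Greatest π ρ = Below π ρ × (∀ σ → Below π σ → σ ⊑ ρ)

  -- Untangling a pattern of π removes an inversion that no σ below π can have.
  untangle : ∀ {π i j k} → InQuot α π → Pattern312 α π i j k →
             Σ (SignedPerm n) λ π′ → InQuot α π′ × inversionCount π′ ℕ.< inversionCount π ×
                                     (∀ {ρ} → Greatest π′ ρ → Greatest π ρ)
  untangle {π} {i} {j} {k} π∈ pat@(i∈ , _ , k∈ , i<j , j<k , _ , _ , ℓi≢ℓk , _ , πi≡πk⁺ , _) =
    untangled , untangled-InQuot α π∈ ℓi≢ℓk ,
    ⊑⇒inversionCount-< untangled⊑π i∈ k∈
      (λ (_ , a⁺<a) → ℤP.<-asym (subst₂ _<_ untangled-k untangled-i a⁺<a) (<⁺ a))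
      (i<k , subst (a <_) (sym πi≡πk⁺) (<⁺ a)) ,
    λ ((ρ∈ , ρ-avoids , ρ⊑untangled) , greatest) →
      (ρ∈ , ρ-avoids , ⊑-trans ρ⊑untangled untangled⊑π) ,
      λ σ (σ∈ , σ-avoids , σ⊑π) →
        greatest σ (σ∈ , σ-avoids , ⊑untangled σ⊑π (pattern-ordered σ∈ σ-avoids σ⊑π pat))
    where
    i<k : i < k
    i<k = ℤP.<-trans i<j j<k
    open Untangle π i∈ k∈ i<k πi≡πk⁺

  greatest-exists : ∀ {π} → InQuot α π → Σ (SignedPerm n) (Greatest π)
  greatest-exists {π} π∈ = go π∈ (<-wellFounded (inversionCount π))
    where
    go : ∀ {π} → InQuot α π → Acc ℕ._<_ (inversionCount π) → Σ (SignedPerm n) (Greatest π)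
    go {π} π∈ (acc rs) with pattern-search α π
    ... | inj₁ π-avoids = π , (π∈ , π-avoids , ⊑-refl) , λ _ (_ , _ , σ⊑π) → σ⊑π
    ... | inj₂ (_ , _ , _ , pat) =
      let (π′ , π′∈ , fewer , transfer) = untangle π∈ pat
          (ρ , greatest) = go π′∈ (rs fewer)
      in ρ , transfer greatest

lemma60 : (n : ℕ) (α : TypeBComp n) (π : SignedPerm n) → InQuot α π →
    Σ (SignedPerm n) (λ ρ → IsDagger α π ρ ×
      ((τ : SignedPerm n) → IsDagger α π τ → τ ≈ₚ ρ))
lemma60 n α π π∈ =
  let (ρ , (ρ∈ , ρ-avoids , ρ⊑π) , greatest) = greatest-exists α π∈
  in ρ ,
     (ρ∈ , ρ-avoids , ⊑⇒⊆ᵢ ρ⊑π ,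
      λ σ σ∈ σ-avoids σ⊆π _ → ⊑⇒⊆ᵢ (greatest σ (σ∈ , σ-avoids , ⊆ᵢ⇒⊑ σ⊆π))) ,
     λ τ (τ∈ , τ-avoids , τ⊆π , τ-maximal) →
       let τ⊑ρ = greatest τ (τ∈ , τ-avoids , ⊆ᵢ⇒⊑ τ⊆π)
       in ⊑-antisym τ⊑ρ (⊆ᵢ⇒⊑ (τ-maximal ρ ρ∈ ρ-avoids (⊑⇒⊆ᵢ ρ⊑π) (⊑⇒⊆ᵢ τ⊑ρ)))
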